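{- Let $A=\{a_1,\ldots,a_k\}\subseteq \mathbb{Z}_m\setminus\{0\}$ be a set of $k$ pairwise distinct elements. Then for each $i\in\{1,\ldots,k\}$, at least one of the following holds: (1) there exists $j\neq i$ such that $a_i+a_j\notin\{0,a_1,\ldots,a_k\}$; (2) there exists an integer $s<k$ such that $A\cup\{0\}=\{a_i,0,-a_i,-2a_i,\ldots,-sa_i\}\cup M$, where $M$ is a union of cosets of the subgroup $\langle a_i\rangle$ generated by $a_i$; moreover, if $M=\emptyset$ then $s=k-1$.
   Context: $\mathbb{Z}_m$ denotes the cyclic group of integers modulo $m$. -}

module Defs where

open import Data.Nat using (ℕ; _+_; _*_; _∸_; _≤_; _<_; NonZero)
open import Data.Nat.DivMod using (_mod_)
open import Data.Fin using (Fin; toℕ)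
open import Data.Fin.Subset using (Subset; _∈_; Empty)
open import Data.Product using (_×_; ∃-syntax)
open import Data.Sum using (_⊎_)
open import Relation.Binary.PropositionalEquality using (_≡_)
open import Relation.Nullary using (¬_)

module ℤ (m : ℕ) .{{_ : NonZero m}} where

  ℤₘ : Set
  ℤₘ = Fin m

  0ₘ : ℤₘ
  0ₘ = 0 mod m

  infixl 6 _+ₘ_
  _+ₘ_ : ℤₘ → ℤₘ → ℤₘ
  x +ₘ y = (toℕ x + toℕ y) mod m

  -ₘ_ : ℤₘ → ℤₘ
  -ₘ x = (m ∸ toℕ x) mod m

  _·ₘ_ : ℕ → ℤₘ → ℤₘ
  n ·ₘ x = (n * toℕ x) mod m

  InCoset : ℤₘ → ℤₘ → ℤₘ → Set
  InCoset a x y = ∃[ n ] (y ≡ x +ₘ (n ·ₘ a))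

  UnionOfCosets : ℤₘ → Subset m → Set
  UnionOfCosets a M = ∀ x y → x ∈ M → InCoset a x y → y ∈ M

  InA∪0 : ∀ {k} → (Fin k → ℤₘ) → ℤₘ → Set
  InA∪0 a x = x ≡ 0ₘ ⊎ ∃[ j ] (x ≡ a j)

  InProg : ℤₘ → ℕ → ℤₘ → Set
  InProg b s x = x ≡ b ⊎ ∃[ t ] (t ≤ s × x ≡ -ₘ (t ·ₘ b))

  Cond2 : ∀ {k} → (Fin k → ℤₘ) → ℤₘ → Set
  Cond2 {k} a b =
    ∃[ s ] (s < k × ∃[ M ] (UnionOfCosets b M
      × (∀ x → (InA∪0 a x → InProg b s x ⊎ x ∈ M) × (InProg b s x ⊎ x ∈ M → InA∪0 a x))
      × (Empty M → s ≡ k ∸ 1)))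

  Cond1 : ∀ {k} → (Fin k → ℤₘ) → Fin k → Set
  Cond1 a i = ∃[ j ] (¬ j ≡ i × ¬ InA∪0 a (a i +ₘ a j))

-- Put b = a_i, S = A ∪ {0}, and suppose (1) fails. Then S is closed under x ↦ x + b at every
-- x ≠ b (at 0 because 0 + b = b). Walk down the progression 0, -b, -2b, … . If it never leaves S,
-- the set S is closed under + b everywhere, hence is a union of cosets of ⟨b⟩, and (2) holds with
-- s = 0 and M = S. Otherwise let -(s+1)b be the first element outside S. The elements 0, -b, …,
-- -(s+1)b are pairwise distinct (a repetition would make the progression periodic inside S), so
-- b, -b, …, -sb are s + 1 distinct elements of A and s < k. Every element of S on the progression
-- is b or some -tb with t ≤ s, since descending from it by + b stays in S until b or 0 is reached.
-- The rest M of S avoids ⟨b⟩ and in particular b, so it is closed under + b, i.e. a union of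
-- cosets; if M = ∅ then A = {b, -b, …, -sb} and k = s + 1.
module Submission where

open import Defs
open import Data.Nat using (ℕ; NonZero; zero; suc; pred; _+_; _*_; _∸_; _≤_; _<_; z≤n; s≤s)
open import Data.Nat.Properties
  using (≤-antisym; ≤-pred; <⇒≤; <-cmp; ≤-<-trans; m≤n⇒m≤1+n; m≤n⇒m<n∨m≡n; m∸n+n≡m; +-monoʳ-<;
         +-comm; +-assoc; +-identityʳ; suc-pred)
open import Data.Nat.DivMod
  using (_%_; _mod_; %-distribˡ-+; %-distribˡ-*; m%n%n≡m%n; m<n⇒m%n≡m; [m+n]%n≡m%n; m%n<n)
open import Data.Nat.Tactic.RingSolver using (solve-∀)
open import Data.Fin using (Fin; toℕ; fromℕ<; zero; suc; _≟_)
open import Data.Fin.Properties using (toℕ-injective; toℕ-fromℕ<; toℕ<n; any?; injective⇒≤)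
open import Data.Fin.Subset using (Subset; _∈_; Empty)
open import Data.Vec using (tabulate)
open import Data.Vec.Properties using (lookup∘tabulate; []=⇒lookup; lookup⇒[]=)
open import Data.Product using (_×_; _,_; proj₁; proj₂; ∃-syntax)
open import Data.Sum using (_⊎_; inj₁; inj₂; [_,_]′)
open import Function using (_∘_; id; case_of_)
open import Function.Definitions using (Injective)
open import Level using (Level; 0ℓ)
open import Relation.Binary.Bundles using (Setoid)
open import Relation.Binary.Definitions using (tri<; tri≈; tri>)
open import Relation.Binary.PropositionalEquality using (_≡_; _≢_; refl; sym; trans; cong; cong₂; subst)
import Relation.Binary.Reasoning.Setoid as SetoidReasoning
open import Relation.Nullary using (¬_; Dec; yes; no; does)
open import Relation.Nullary.Decidable using (_×-dec_; _⊎-dec_; ¬?; dec-true; decidable-stable)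
open import Relation.Nullary.Negation using (contradiction)
open import Relation.Unary using (Pred; Decidable)

private
  variable
    p : Level

module _ {n : ℕ} {P : Pred (Fin n) p} (P? : Decidable P) where

  toSubset : Subset n
  toSubset = tabulate (does ∘ P?)

  ∈-toSubset⁺ : ∀ {x} → P x → x ∈ toSubset
  ∈-toSubset⁺ {x} px = lookup⇒[]= x _ (trans (lookup∘tabulate _ x) (dec-true (P? x) px))

  ∈-toSubset⁻ : ∀ {x} → x ∈ toSubset → P x
  ∈-toSubset⁻ {x} x∈ with P? x | trans (sym (lookup∘tabulate (does ∘ P?) x)) ([]=⇒lookup x∈)
  ... | yes px | _ = px
  ... | no _   | ()

⊆-image⇒≤ : ∀ {n k} {X : Set p} (f : Fin n → X) (g : Fin k → X) →
            Injective _≡_ _≡_ f → (∀ t → ∃[ j ] f t ≡ g j) → n ≤ k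
⊆-image⇒≤ f g f-injective f⊆g = injective⇒≤ {f = proj₁ ∘ f⊆g} λ {t} {t′} j≡j′ →
  f-injective (trans (proj₂ (f⊆g t)) (trans (cong g j≡j′) (sym (proj₂ (f⊆g t′)))))

module _ {P : Pred ℕ p} (P? : Decidable P) (P0 : P 0) where

  upTo⊎leastFailure : ∀ n → (∀ {t} → t ≤ n → P t) ⊎ ∃[ s ] ((∀ {t} → t ≤ s → P t) × ¬ P (suc s))
  upTo⊎leastFailure zero = inj₁ λ { z≤n → P0 }
  upTo⊎leastFailure (suc n) with upTo⊎leastFailure n
  ... | inj₂ failure = inj₂ failure
  ... | inj₁ P≤n with P? (suc n)
  ...   | no ¬P = inj₂ (n , P≤n , ¬P)
  ...   | yes P = inj₁ λ t≤1+n → case m≤n⇒m<n∨m≡n t≤1+n of λ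
    { (inj₁ t<1+n) → P≤n (≤-pred t<1+n)
    ; (inj₂ refl) → P }

module Residues (m : ℕ) .{{_ : NonZero m}} where
  open ℤ m

  infix 4 _≈_
  record _≈_ (u v : ℕ) : Set where
    constructor mk≈
    field %-≡ : u % m ≡ v % m
  open _≈_

  ≈-setoid : Setoid 0ℓ 0ℓ
  ≈-setoid = record
    { Carrier = ℕ
    ; _≈_ = _≈_
    ; isEquivalence = record
      { refl = mk≈ refl
      ; sym = λ u≈v → mk≈ (sym (%-≡ u≈v))
      ; trans = λ u≈v v≈w → mk≈ (trans (%-≡ u≈v) (%-≡ v≈w))
      }
    }

  open Setoid ≈-setoid using () renaming (refl to ≈-refl; sym to ≈-sym; trans to ≈-trans)

  ≡⇒≈ : ∀ {u v} → u ≡ v → u ≈ v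
  ≡⇒≈ refl = ≈-refl

  %-≈ : ∀ u → u % m ≈ u
  %-≈ u = mk≈ (m%n%n≡m%n u m)

  m≈0 : m ≈ 0
  m≈0 = mk≈ ([m+n]%n≡m%n 0 m)

  +-cong : ∀ {u u′ v v′} → u ≈ u′ → v ≈ v′ → u + v ≈ u′ + v′
  +-cong {u} {u′} {v} {v′} (mk≈ u≡u′) (mk≈ v≡v′) = mk≈ (trans (%-distribˡ-+ u v m)
    (trans (cong₂ (λ x y → (x + y) % m) u≡u′ v≡v′) (sym (%-distribˡ-+ u′ v′ m))))

  *-cong : ∀ {u u′ v v′} → u ≈ u′ → v ≈ v′ → u * v ≈ u′ * v′
  *-cong {u} {u′} {v} {v′} (mk≈ u≡u′) (mk≈ v≡v′) = mk≈ (trans (%-distribˡ-* u v m)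
    (trans (cong₂ (λ x y → (x * y) % m) u≡u′ v≡v′) (sym (%-distribˡ-* u′ v′ m))))

  +-inverseʳ : ∀ u → ∃[ u′ ] u + u′ ≈ 0
  +-inverseʳ u = m ∸ u % m , (begin
    u + (m ∸ u % m)       ≈⟨ +-cong (%-≈ u) ≈-refl ⟨
    u % m + (m ∸ u % m)   ≡⟨ +-comm (u % m) _ ⟩
    (m ∸ u % m) + u % m   ≡⟨ m∸n+n≡m (<⇒≤ (m%n<n u m)) ⟩
    m                     ≈⟨ m≈0 ⟩
    0                     ∎)
    where open SetoidReasoning ≈-setoid

  +-cancelʳ-≈ : ∀ {u v} w → u + w ≈ v + w → u ≈ v
  +-cancelʳ-≈ {u} {v} w u+w≈v+w = begin
    u               ≡⟨ +-identityʳ u ⟨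
    u + 0           ≈⟨ +-cong ≈-refl w+w′≈0 ⟨
    u + (w + w′)    ≡⟨ +-assoc u w w′ ⟨
    (u + w) + w′    ≈⟨ +-cong u+w≈v+w ≈-refl ⟩
    (v + w) + w′    ≡⟨ +-assoc v w w′ ⟩
    v + (w + w′)    ≈⟨ +-cong ≈-refl w+w′≈0 ⟩
    v + 0           ≡⟨ +-identityʳ v ⟩
    v               ∎
    where
    open SetoidReasoning ≈-setoid
    w′ = proj₁ (+-inverseʳ w)
    w+w′≈0 = proj₂ (+-inverseʳ w)

  toℕ-mod : ∀ u → toℕ (u mod m) ≈ u
  toℕ-mod u = ≈-trans (≡⇒≈ (toℕ-fromℕ< (m%n<n u m))) (%-≈ u)

  toℕ-injective-≈ : ∀ {x y : ℤₘ} → toℕ x ≈ toℕ y → x ≡ y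
  toℕ-injective-≈ {x} {y} (mk≈ x≡y) = toℕ-injective
    (trans (sym (m<n⇒m%n≡m (toℕ<n x))) (trans x≡y (m<n⇒m%n≡m (toℕ<n y))))

  -ₘ-inverseˡ : ∀ x → toℕ (-ₘ x) + toℕ x ≈ 0
  -ₘ-inverseˡ x = ≈-trans (+-cong (toℕ-mod (m ∸ toℕ x)) ≈-refl)
    (≈-trans (≡⇒≈ (m∸n+n≡m (<⇒≤ (toℕ<n x)))) m≈0)

  +ₘ-comm : ∀ x y → x +ₘ y ≡ y +ₘ x
  +ₘ-comm x y = cong (_mod m) (+-comm (toℕ x) (toℕ y))

  +ₘ-identityˡ : ∀ x → 0ₘ +ₘ x ≡ x
  +ₘ-identityˡ x = toℕ-injective-≈ (≈-trans (toℕ-mod _) (+-cong (toℕ-mod 0) ≈-refl))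

  +ₘ-cancelʳ : ∀ {x y} z → x +ₘ z ≡ y +ₘ z → x ≡ y
  +ₘ-cancelʳ {x} {y} z x+z≡y+z = toℕ-injective-≈ (+-cancelʳ-≈ (toℕ z)
    (≈-trans (≈-sym (toℕ-mod _)) (≈-trans (≡⇒≈ (cong toℕ x+z≡y+z)) (toℕ-mod _))))

  module Multiples (b : ℤₘ) where

    negMul : ℕ → ℤₘ
    negMul t = -ₘ (t ·ₘ b)

    negMul-inverse : ∀ t → toℕ (negMul t) + t * toℕ b ≈ 0
    negMul-inverse t = ≈-trans (+-cong ≈-refl (≈-sym (toℕ-mod _))) (-ₘ-inverseˡ (t ·ₘ b))

    ≈0⇒≡negMul : ∀ {x} t → toℕ x + t * toℕ b ≈ 0 → x ≡ negMul t
    ≈0⇒≡negMul t x+tb≈0 = toℕ-injective-≈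
      (+-cancelʳ-≈ (t * toℕ b) (≈-trans x+tb≈0 (≈-sym (negMul-inverse t))))

    negMul-zero : negMul 0 ≡ 0ₘ
    negMul-zero = sym (≈0⇒≡negMul 0 (≈-trans (≡⇒≈ (+-identityʳ (toℕ 0ₘ))) (toℕ-mod 0)))

    negMul-suc : ∀ t → negMul (suc t) +ₘ b ≡ negMul t
    negMul-suc t = ≈0⇒≡negMul t (begin
      toℕ (negMul (suc t) +ₘ b) + t * toℕ b    ≈⟨ +-cong (toℕ-mod _) ≈-refl ⟩
      (toℕ (negMul (suc t)) + toℕ b) + t * toℕ b ≡⟨ +-assoc (toℕ (negMul (suc t))) _ _ ⟩
      toℕ (negMul (suc t)) + suc t * toℕ b       ≈⟨ negMul-inverse (suc t) ⟩
      0                                          ∎)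
      where open SetoidReasoning ≈-setoid

    +b≡negMul⇒ : ∀ {x} t → x +ₘ b ≡ negMul t → x ≡ negMul (suc t)
    +b≡negMul⇒ {x} t x+b≡negMul = ≈0⇒≡negMul (suc t) (begin
      toℕ x + suc t * toℕ b       ≡⟨ +-assoc (toℕ x) _ _ ⟨
      (toℕ x + toℕ b) + t * toℕ b ≈⟨ +-cong (toℕ-mod _) ≈-refl ⟨
      toℕ (x +ₘ b) + t * toℕ b     ≡⟨ cong (λ y → toℕ y + t * toℕ b) x+b≡negMul ⟩
      toℕ (negMul t) + t * toℕ b   ≈⟨ negMul-inverse t ⟩
      0                            ∎)
      where open SetoidReasoning ≈-setoid

    negMul≡b⇒ : ∀ {t} → negMul t ≡ b → negMul (suc t) ≡ negMul 0
    negMul≡b⇒ {t} negMul≡b =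
      sym (trans negMul-zero (+b≡negMul⇒ t (trans (+ₘ-identityˡ b) (sym negMul≡b))))

    negMul-shift : ∀ {u v} → negMul u ≡ negMul v → ∀ d → negMul (d + u) ≡ negMul (d + v)
    negMul-shift u≡v zero = u≡v
    negMul-shift {u} {v} u≡v (suc d) = +ₘ-cancelʳ b
      (trans (negMul-suc (d + u)) (trans (negMul-shift u≡v d) (sym (negMul-suc (d + v)))))

    -- Adding b subtracts (m - 1)b because mb = 0; here m ≠ 0 makes pred m + 1 = m.
    negMul-+b : ∀ t → negMul t +ₘ b ≡ negMul (t + pred m)
    negMul-+b t = ≈0⇒≡negMul (t + pred m) (begin
      toℕ (negMul t +ₘ b) + (t + pred m) * β ≈⟨ +-cong (toℕ-mod _) ≈-refl ⟩
      (z + β) + (t + pred m) * β             ≡⟨ regroup z β t (pred m) ⟩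
      (z + t * β) + suc (pred m) * β         ≡⟨ cong (λ n → (z + t * β) + n * β) (suc-pred m) ⟩
      (z + t * β) + m * β                    ≈⟨ +-cong (negMul-inverse t) (*-cong m≈0 ≈-refl) ⟩
      0                                      ∎)
      where
      open SetoidReasoning ≈-setoid
      z = toℕ (negMul t)
      β = toℕ b
      regroup : ∀ z b t p → (z + b) + (t + p) * b ≡ (z + t * b) + suc p * b
      regroup = solve-∀

    b≡negMul : b ≡ negMul (pred m)
    b≡negMul = trans (sym (+ₘ-identityˡ b)) (trans (cong (_+ₘ b) (sym negMul-zero)) (negMul-+b 0))

    negMul-mod : ∀ t → negMul t ≡ negMul (toℕ (t mod m))
    negMul-mod t = ≈0⇒≡negMul (toℕ (t mod m))
      (≈-trans (+-cong ≈-refl (*-cong (toℕ-mod t) ≈-refl)) (negMul-inverse t))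

    NegMultiple : Pred ℤₘ 0ℓ
    NegMultiple x = ∃[ t ] x ≡ negMul (toℕ {m} t)

    negMultiple? : Decidable NegMultiple
    negMultiple? x = any? λ t → x ≟ negMul (toℕ t)

    negMultiple : ∀ {x} t → x ≡ negMul t → NegMultiple x
    negMultiple t refl = t mod m , negMul-mod t

    +ₘ-·ₘ-zero : ∀ x → x +ₘ (0 ·ₘ b) ≡ x
    +ₘ-·ₘ-zero x = toℕ-injective-≈ (≈-trans (toℕ-mod _)
      (≈-trans (+-cong ≈-refl (toℕ-mod 0)) (≡⇒≈ (+-identityʳ (toℕ x)))))

    +ₘ-·ₘ-suc : ∀ x n → x +ₘ (suc n ·ₘ b) ≡ (x +ₘ (n ·ₘ b)) +ₘ b
    +ₘ-·ₘ-suc x n = toℕ-injective-≈ (begin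
      toℕ (x +ₘ (suc n ·ₘ b))          ≈⟨ toℕ-+ₘ-·ₘ (suc n) ⟩
      toℕ x + (toℕ b + n * toℕ b)      ≡⟨ swap (toℕ x) (toℕ b) (n * toℕ b) ⟩
      (toℕ x + n * toℕ b) + toℕ b      ≈⟨ +-cong (toℕ-+ₘ-·ₘ n) ≈-refl ⟨
      toℕ (x +ₘ (n ·ₘ b)) + toℕ b      ≈⟨ toℕ-mod (toℕ (x +ₘ (n ·ₘ b)) + toℕ b) ⟨
      toℕ ((x +ₘ (n ·ₘ b)) +ₘ b)       ∎)
      where
      open SetoidReasoning ≈-setoid
      toℕ-+ₘ-·ₘ : ∀ n → toℕ (x +ₘ (n ·ₘ b)) ≈ toℕ x + n * toℕ b
      toℕ-+ₘ-·ₘ n = ≈-trans (toℕ-mod (toℕ x + toℕ (n ·ₘ b))) (+-cong ≈-refl (toℕ-mod (n * toℕ b)))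
      swap : ∀ x b c → x + (b + c) ≡ (x + c) + b
      swap = solve-∀

    +b-closed⇒unionOfCosets : ∀ {P : Pred ℤₘ p} (P? : Decidable P) →
                              (∀ {x} → P x → P (x +ₘ b)) → UnionOfCosets b (toSubset P?)
    +b-closed⇒unionOfCosets {P = P} P? closed x y x∈ (n , refl) =
      ∈-toSubset⁺ P? (coset n)
      where
      coset : ∀ n → P (x +ₘ (n ·ₘ b))
      coset zero = subst P (sym (+ₘ-·ₘ-zero x)) (∈-toSubset⁻ P? x∈)
      coset (suc n) = subst P (sym (+ₘ-·ₘ-suc x n)) (closed (coset n))

module Proposition (m : ℕ) .{{_ : NonZero m}} (k : ℕ) (a : Fin k → Fin m)
                   (a-injective : Injective _≡_ _≡_ a) (a≢0 : ∀ j → ¬ a j ≡ ℤ.0ₘ m) (i : Fin k) where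
  open ℤ m
  open Residues m

  b : ℤₘ
  b = a i

  open Multiples b

  S : Pred ℤₘ 0ℓ
  S = InA∪0 a

  S? : Decidable S
  S? x = (x ≟ 0ₘ) ⊎-dec any? (λ j → x ≟ a j)

  S-nonzero⇒∈A : ∀ {x} → S x → x ≢ 0ₘ → ∃[ j ] x ≡ a j
  S-nonzero⇒∈A (inj₁ x≡0) x≢0 = contradiction x≡0 x≢0
  S-nonzero⇒∈A (inj₂ x∈A) _ = x∈A

  InProg⇒S : ∀ {s x} → (∀ {t} → t ≤ s → S (negMul t)) → InProg b s x → S x
  InProg⇒S _ (inj₁ refl) = inj₂ (i , refl)
  InProg⇒S S≤s (inj₂ (t , t≤s , refl)) = S≤s t≤s

  0<k : 0 < k
  0<k = ≤-<-trans z≤n (toℕ<n i)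

  cond1? : Dec (Cond1 a i)
  cond1? = any? λ j → ¬? (j ≟ i) ×-dec ¬? (S? (b +ₘ a j))

  module NotCond1 (¬cond1 : ¬ Cond1 a i) where

    S-+b : ∀ {x} → S x → x ≢ b → S (x +ₘ b)
    S-+b (inj₁ refl) _ = subst S (sym (+ₘ-identityˡ b)) (inj₂ (i , refl))
    S-+b (inj₂ (j , refl)) aj≢b = subst S (+ₘ-comm b (a j))
      (decidable-stable (S? (b +ₘ a j)) λ ¬S → ¬cond1 (j , (aj≢b ∘ cong a) , ¬S))

    cond2-periodic : (∀ t → S (negMul t)) → Cond2 a b
    cond2-periodic S-negMul =
      0 , 0<k , toSubset S? , +b-closed⇒unionOfCosets S? S-closed ,
      (λ x → inj₂ ∘ ∈-toSubset⁺ S? , [ InProg⇒S (λ {t} _ → S-negMul t) , ∈-toSubset⁻ S? ]′) ,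
      λ empty → contradiction (0ₘ , ∈-toSubset⁺ S? (inj₁ refl)) empty
      where
      S-closed : ∀ {x} → S x → S (x +ₘ b)
      S-closed {x} Sx with x ≟ b
      ... | no x≢b = S-+b Sx x≢b
      ... | yes refl = subst S (sym b+b≡negMul) (S-negMul (pred m + pred m))
        where
        b+b≡negMul : b +ₘ b ≡ negMul (pred m + pred m)
        b+b≡negMul = trans (cong (_+ₘ b) b≡negMul) (negMul-+b (pred m))

    module FirstExit (s : ℕ) (S≤s : ∀ {t} → t ≤ s → S (negMul t)) (¬S-next : ¬ S (negMul (suc s))) where

      S-bounded : ∀ {t} → t ≤ suc s → S (negMul t) → t ≤ s
      S-bounded t≤1+s St = case m≤n⇒m<n∨m≡n t≤1+s of λ
        { (inj₁ t<1+s) → ≤-pred t<1+s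
        ; (inj₂ refl) → contradiction St ¬S-next }

      -- A repetition u < v ≤ s + 1 would carry -(s+1)b back to -(s+1-(v-u))b, which lies in S.
      negMul-injective< : ∀ {u v} → u < v → v ≤ suc s → negMul u ≢ negMul v
      negMul-injective< {u} {v} u<v v≤1+s u≡v = ¬S-next (subst S reach (S≤s earlier))
        where
        d = suc s ∸ v
        d+v≡1+s : d + v ≡ suc s
        d+v≡1+s = m∸n+n≡m v≤1+s
        reach : negMul (d + u) ≡ negMul (suc s)
        reach = trans (negMul-shift u≡v d) (cong negMul d+v≡1+s)
        earlier : d + u ≤ s
        earlier = ≤-pred (subst (d + u <_) d+v≡1+s (+-monoʳ-< d u<v))

      negMul-injective : ∀ {u v} → u ≤ suc s → v ≤ suc s → negMul u ≡ negMul v → u ≡ v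
      negMul-injective {u} {v} u≤ v≤ u≡v with <-cmp u v
      ... | tri< u<v _ _ = contradiction u≡v (negMul-injective< u<v v≤)
      ... | tri≈ _ u≡v′ _ = u≡v′
      ... | tri> _ _ v<u = contradiction (sym u≡v) (negMul-injective< v<u u≤)

      negMul≢b : ∀ {t} → t ≤ s → negMul t ≢ b
      negMul≢b {t} t≤s negMul≡b with negMul-injective (s≤s t≤s) z≤n (negMul≡b⇒ {t} negMul≡b)
      ... | ()

      negMul≢0 : ∀ {t} → t ≤ s → negMul (suc t) ≢ 0ₘ
      negMul≢0 {t} t≤s negMul≡0 with negMul-injective (s≤s t≤s) z≤n (trans negMul≡0 (sym negMul-zero))
      ... | ()

      S-negMul⇒InProg : ∀ t → S (negMul t) → InProg b s (negMul t)
      S-negMul⇒InProg zero _ = inj₂ (0 , z≤n , refl)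
      S-negMul⇒InProg (suc t) St with negMul (suc t) ≟ b
      ... | yes negMul≡b = inj₁ negMul≡b
      ... | no negMul≢b′ with S-negMul⇒InProg t (subst S (negMul-suc t) (S-+b St negMul≢b′))
      ...   | inj₁ negMul≡b = inj₂ (0 , z≤n , negMul≡b⇒ {t} negMul≡b)
      ...   | inj₂ (t′ , t′≤s , t≡t′) = inj₂ (suc t′ , S-bounded (s≤s t′≤s) (subst S next St) , next)
        where
        next : negMul (suc t) ≡ negMul (suc t′)
        next = negMul-shift {t} {t′} t≡t′ 1

      progression : Fin (suc s) → ℤₘ
      progression zero = b
      progression (suc t) = negMul (suc (toℕ t))

      progression-injective : Injective _≡_ _≡_ progression
      progression-injective {zero} {zero} _ = refl
      progression-injective {zero} {suc t} b≡ = contradiction (sym b≡) (negMul≢b (toℕ<n t))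
      progression-injective {suc t} {zero} ≡b = contradiction ≡b (negMul≢b (toℕ<n t))
      progression-injective {suc t} {suc t′} t≡t′ = cong suc (toℕ-injective (cong pred
        (negMul-injective (m≤n⇒m≤1+n (toℕ<n t)) (m≤n⇒m≤1+n (toℕ<n t′)) t≡t′)))

      progression⊆A : ∀ t → ∃[ j ] progression t ≡ a j
      progression⊆A zero = i , refl
      progression⊆A (suc t) = S-nonzero⇒∈A (S≤s (toℕ<n t)) (negMul≢0 (<⇒≤ (toℕ<n t)))

      InProg⇒progression : ∀ {x} → InProg b s x → x ≢ 0ₘ → ∃[ t ] x ≡ progression t
      InProg⇒progression (inj₁ x≡b) _ = zero , x≡b
      InProg⇒progression (inj₂ (zero , _ , x≡0)) x≢0 = contradiction (trans x≡0 negMul-zero) x≢0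
      InProg⇒progression (inj₂ (suc t , t<s , x≡)) _ =
        suc (fromℕ< t<s) , trans x≡ (cong (negMul ∘ suc) (sym (toℕ-fromℕ< t<s)))

      s<k : s < k
      s<k = ⊆-image⇒≤ progression a progression-injective progression⊆A

      Sporadic : Pred ℤₘ 0ℓ
      Sporadic x = S x × ¬ NegMultiple x

      sporadic? : Decidable Sporadic
      sporadic? x = S? x ×-dec ¬? (negMultiple? x)

      M : Subset m
      M = toSubset sporadic?

      sporadic-+b : ∀ {x} → Sporadic x → Sporadic (x +ₘ b)
      sporadic-+b (Sx , ¬nx) =
        S-+b Sx (λ x≡b → ¬nx (negMultiple (pred m) (trans x≡b b≡negMul))) ,
        λ (t , x+b≡) → ¬nx (negMultiple (suc (toℕ t)) (+b≡negMul⇒ (toℕ t) x+b≡))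

      S⇒InProg⊎M : ∀ x → S x → InProg b s x ⊎ x ∈ M
      S⇒InProg⊎M x Sx with negMultiple? x
      ... | no ¬nx = inj₂ (∈-toSubset⁺ sporadic? (Sx , ¬nx))
      ... | yes (t , refl) = inj₁ (S-negMul⇒InProg (toℕ t) Sx)

      M-empty⇒s≡k∸1 : Empty M → s ≡ k ∸ 1
      M-empty⇒s≡k∸1 M-empty = cong (_∸ 1) (sym (≤-antisym k≤1+s s<k))
        where
        A⊆progression : ∀ j → ∃[ t ] a j ≡ progression t
        A⊆progression j = InProg⇒progression
          ([ id , (λ aj∈M → contradiction (a j , aj∈M) M-empty) ]′ (S⇒InProg⊎M (a j) (inj₂ (j , refl))))
          (a≢0 j)
        k≤1+s : k ≤ suc s
        k≤1+s = ⊆-image⇒≤ a progression a-injective A⊆progression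

      cond2 : Cond2 a b
      cond2 = s , s<k , M , +b-closed⇒unionOfCosets sporadic? sporadic-+b ,
        (λ x → S⇒InProg⊎M x , [ InProg⇒S S≤s , proj₁ ∘ ∈-toSubset⁻ sporadic? ]′) ,
        M-empty⇒s≡k∸1

    cond2 : Cond2 a b
    cond2 with upTo⊎leastFailure (S? ∘ negMul) (subst S (sym negMul-zero) (inj₁ refl)) m
    ... | inj₁ S≤m = cond2-periodic λ t →
      subst S (sym (negMul-mod t)) (S≤m (<⇒≤ (toℕ<n (t mod m))))
    ... | inj₂ (s , S≤s , ¬S-next) = FirstExit.cond2 s S≤s ¬S-next

proposition2p3 : (m : ℕ) .{{_ : NonZero m}} (k : ℕ) (a : Fin k → Fin m)
    → Injective _≡_ _≡_ a
    → (∀ j → ¬ a j ≡ ℤ.0ₘ m)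
    → ∀ i → ℤ.Cond1 m a i ⊎ ℤ.Cond2 m a (a i)
proposition2p3 m k a a-injective a≢0 i with Proposition.cond1? m k a a-injective a≢0 i
... | yes cond1 = inj₁ cond1
... | no ¬cond1 = inj₂ (Proposition.NotCond1.cond2 m k a a-injective a≢0 i ¬cond1)
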